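{- For all integers $t \geq 1$ and $s \geq 1$, let $G(t,s)$ be the graph obtained as follows: take a cycle $C_{4t}$ with vertices $v_0, v_1, \dots, v_{4t-1}$ (indices taken modulo $4t$, edges $v_j v_{j+1}$), and for each $i \in \{0,1,\dots,2t-1\}$ add $s-1$ new vertices, each adjacent exactly to $v_{2i}$ and $v_{2i+2}$ (so that $v_{2i}$, $v_{2i+2}$, the cycle vertex $v_{2i+1}$ and these $s-1$ new vertices induce a copy of $K(2,s)$ on the alternate cycle nodes $v_{2i}, v_{2i+2}$). Then $G(t,s)$, which has order $p = 2t(s+1)$ and size $q = 4ts$, is graceful.
   Context: Graphs are finite, undirected, simple. A $(p,q)$-graph has $p$ vertices and $q$ edges. A graceful labeling of a $(p,q)$-graph $G$ is an injective map $\varphi: V(G) \to \{0,1,\dots,q\}$ such that the induced edge labels $|\varphi(u)-\varphi(v)|$, over all edges $uv$ of $G$, are exactly the numbers $1,2,\dots,q$ (each once). A graph is graceful if it admits a graceful labeling. $K(2,s)$ denotes the complete bipartite graph with parts of sizes $2$ and $s$. -}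

module Defs where

open import Data.Nat using (ℕ; zero; suc; _*_; _∸_; _≤_; _<?_; ∣_-_∣)
open import Data.Fin using (Fin; toℕ; fromℕ<; combine)
open import Data.List using (List; []; _∷_; _++_; map; concatMap; allFin; upTo; length)
open import Data.List.Relation.Binary.Permutation.Propositional using (_↭_)
open import Data.Product using (_×_; _,_; Σ; proj₁; proj₂)
open import Relation.Binary.PropositionalEquality using (_≡_)
open import Relation.Nullary using (yes; no)

-- A finite simple graph given by a vertex type and its list of edges
-- (each edge listed exactly once, as an unordered pair written (u , v)).
record Graph : Set₁ where
  field
    Vertex : Set
    edges  : List (Vertex × Vertex)

open Graph public

size : Graph → ℕ
size G = length (edges G)

IsGracefulLabeling : (G : Graph) → (Vertex G → ℕ) → Set
IsGracefulLabeling G φ =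
  (∀ u v → φ u ≡ φ v → u ≡ v)
  × (∀ v → φ v ≤ size G)
  × (map (λ e → ∣ φ (proj₁ e) - φ (proj₂ e) ∣) (edges G) ↭ map suc (upTo (size G)))

Graceful : Graph → Set
Graceful G = Σ (Vertex G → ℕ) (IsGracefulLabeling G)

next : ∀ {n} → Fin n → Fin n
next {suc n} j with suc (toℕ j) <? suc n
... | yes p = fromℕ< p
... | no _  = Fin.zero

-- Vertices of G(t,s): cycle vertices v_j, j ∈ Fin ((2t)·2) = Fin (4t),
-- and added vertices w_{i,k}, i ∈ Fin (2t), k ∈ Fin (s-1).
data GV (t s : ℕ) : Set where
  cyc : Fin ((2 * t) * 2) → GV t s
  new : Fin (2 * t) → Fin (s ∸ 1) → GV t s

-- v_{2i} (combine i 0 has value 2i)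
even : ∀ {t} → Fin (2 * t) → Fin ((2 * t) * 2)
even i = combine i Fin.zero

cycleEdges : (t s : ℕ) → List (GV t s × GV t s)
cycleEdges t s = map (λ j → cyc j , cyc (next j)) (allFin ((2 * t) * 2))

addedEdges : (t s : ℕ) → List (GV t s × GV t s)
addedEdges t s =
  concatMap (λ i → concatMap (λ k →
      (new i k , cyc (even {t} i)) ∷ (new i k , cyc (next (next (even {t} i)))) ∷ [])
    (allFin (s ∸ 1)))
  (allFin (2 * t))

G : (t s : ℕ) → Graph
G t s = record { Vertex = GV t s ; edges = cycleEdges t s ++ addedEdges t s }

-- Label the cycle vertex v_{2h} by h.  Every other vertex is a hub joined to v_{2h} and v_{2h+2}
-- for some h < 2t: the added vertex w_{h,k} in layer k < s − 1, the cycle vertex v_{2h+1} in layer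
-- s − 1.  A hub of layer k gets the label 4tk + 4t − d(h), where d(h) = h for h < t and h + 1 otherwise,
-- so its two edges have labels 4tk + 4t − (d(h) + h) and 4tk + 4t − (d(h) + h′), h′ = h + 1 mod 2t.
-- As h runs over 0 … 2t − 1 these subtrahends run over 0 … 4t − 1 exactly once: the shift in d
-- leaves the value 2t free for the wrap-around edge (h′ = 0).  Hence each layer fills the block
-- (4tk , 4t(k + 1)] of edge labels, and as there are 4ts edges, the edge labels are 1 … 4ts.

module Submission where

open import Defs
open import Data.Empty using (⊥-elim)
open import Data.Fin using (Fin; toℕ; fromℕ<; combine; remQuot)
open import Data.Fin.Patterns using (0F; 1F)
open import Data.Fin.Properties
  using (toℕ-fromℕ<; toℕ-combine; toℕ-injective; toℕ<n; remQuot-combine; combine-remQuot)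
open import Data.List using (List; []; _∷_; _++_; map; concatMap; allFin; upTo; length)
open import Data.List.Properties using (length-++; length-map; length-upTo; length-tabulate)
open import Data.List.Membership.Propositional using (_∈_)
open import Data.List.Membership.Propositional.Properties
  using (∈-∃++; ∈-++⁺ˡ; ∈-++⁺ʳ; ∈-++⁻; ∈-map⁺; ∈-map⁻; ∈-allFin; ∈-upTo⁻; ∈-concat⁺′)
open import Data.List.Relation.Binary.Subset.Propositional using (_⊆_)
open import Data.List.Relation.Binary.Permutation.Propositional using (_↭_; ↭-refl; ↭-prep; ↭-trans)
open import Data.List.Relation.Binary.Permutation.Propositional.Properties using (shift)
open import Data.List.Relation.Unary.All using (lookup)
open import Data.List.Relation.Unary.AllPairs using (_∷_)
open import Data.List.Relation.Unary.Any using (here; there)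
open import Data.List.Relation.Unary.Unique.Propositional using (Unique)
import Data.List.Relation.Unary.Unique.Propositional.Properties as Unique
open import Data.Nat using (ℕ; zero; suc; pred; _+_; _*_; _∸_; _≤_; _<_; _<?_; ∣_-_∣; z<s; s≤s; s≤s⁻¹; NonZero; >-nonZero)
open import Data.Nat.DivMod using (_/_; _%_; m≡m%n+[m/n]*n; m%n<n; m<n*o⇒m/o<n)
open import Data.Nat.Properties
open import Data.Product using (_×_; _,_; proj₁; proj₂; ∃-syntax; uncurry)
open import Data.Sum using (_⊎_; inj₁; inj₂)
open import Function using (_∘_)
open import Relation.Binary.Definitions using (tri<; tri≈; tri>)
open import Relation.Binary.PropositionalEquality
open import Relation.Nullary using (Dec; yes; no; contradiction)

unique-⊆-length⇒↭ : {A : Set} {xs ys : List A} →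
                     Unique ys → ys ⊆ xs → length xs ≤ length ys → xs ↭ ys
unique-⊆-length⇒↭ {xs = []}    {[]}     _ _ _  = ↭-refl
unique-⊆-length⇒↭ {xs = _ ∷ _} {[]}     _ _ ()
unique-⊆-length⇒↭ {xs = xs}    {y ∷ ys} (y∉ys ∷ unique) ⊆xs len
  with as , bs , refl ← ∈-∃++ (⊆xs (here refl)) =
  ↭-trans (shift y as bs) (↭-prep y (unique-⊆-length⇒↭ unique ⊆as++bs len′))
  where
  ⊆as++bs : ys ⊆ as ++ bs
  ⊆as++bs {z} z∈ys with ∈-++⁻ as (⊆xs (there z∈ys))
  ... | inj₁ z∈as         = ∈-++⁺ˡ z∈as
  ... | inj₂ (here refl)  = ⊥-elim (lookup y∉ys z∈ys refl)
  ... | inj₂ (there z∈bs) = ∈-++⁺ʳ as z∈bs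
  len′ : length (as ++ bs) ≤ length ys
  len′ rewrite length-++ as {bs} | length-++ as {y ∷ bs} | +-suc (length as) (length bs) = s≤s⁻¹ len

length-concatMap-const : {A B : Set} (f : A → List B) {m : ℕ} →
                         (∀ x → length (f x) ≡ m) → ∀ xs → length (concatMap f xs) ≡ length xs * m
length-concatMap-const f const []       = refl
length-concatMap-const f const (x ∷ xs) =
  trans (length-++ (f x)) (cong₂ _+_ (const x) (length-concatMap-const f const xs))

length-allFin : ∀ n → length (allFin n) ≡ n
length-allFin n = length-tabulate (λ i → i)

parity : ∀ m → ∃[ q ] (m ≡ q + q ⊎ m ≡ suc (q + q))
parity zero          = zero , inj₁ refl
parity (suc zero)    = zero , inj₂ refl
parity (suc (suc m)) with parity m
... | q , inj₁ refl = suc q , inj₁ (cong suc (sym (+-suc q q)))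
... | q , inj₂ refl = suc q , inj₂ (cong (suc ∘ suc) (sym (+-suc q q)))

double-<-cancel : ∀ {a b} → a + a < b + b → a < b
double-<-cancel {a} {b} a+a<b+b with a <? b
... | yes a<b = a<b
... | no  a≮b = contradiction a+a<b+b (≤⇒≯ (+-mono-≤ (≮⇒≥ a≮b) (≮⇒≥ a≮b)))

m≤n⇒m<[1+k]*n+o : ∀ n k {m o} → m ≤ n → 0 < o → m < suc k * n + o
m≤n⇒m<[1+k]*n+o n k m≤n o>0 = ≤-<-trans (≤-trans m≤n (m≤m+n n (k * n))) (m<m+n (suc k * n) o>0)

*+-injective : ∀ n {k k′ x x′} → 0 < x → x ≤ n → 0 < x′ → x′ ≤ n →
               k * n + x ≡ k′ * n + x′ → k ≡ k′ × x ≡ x′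
*+-injective n {zero}  {zero}   _   _   _    _    eq = refl , eq
*+-injective n {zero}  {suc k′} _   x≤n x′>0 _    eq = contradiction eq (<⇒≢ (m≤n⇒m<[1+k]*n+o n k′ x≤n x′>0))
*+-injective n {suc k} {zero}   x>0 _   _    x′≤n eq = contradiction (sym eq) (<⇒≢ (m≤n⇒m<[1+k]*n+o n k x′≤n x>0))
*+-injective n {suc k} {suc k′} x>0 x≤n x′>0 x′≤n eq
  with k≡k′ , x≡x′ ← *+-injective n x>0 x≤n x′>0 x′≤n
         (+-cancelˡ-≡ n _ _ (trans (sym (+-assoc n (k * n) _)) (trans eq (+-assoc n (k′ * n) _))))
  = cong suc k≡k′ , x≡x′

-- The cycle Fin (n * 2)

toℕ-next-< : ∀ {n} (j : Fin n) → suc (toℕ j) < n → toℕ (next j) ≡ suc (toℕ j)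
toℕ-next-< {suc n} j j+1<n with suc (toℕ j) <? suc n
... | yes j+1<n′ = toℕ-fromℕ< j+1<n′
... | no  j+1≮n  = contradiction j+1<n j+1≮n

toℕ-next-last : ∀ {n} (j : Fin n) → suc (toℕ j) ≡ n → toℕ (next j) ≡ 0
toℕ-next-last {suc n} j j+1≡n with suc (toℕ j) <? suc n
... | yes j+1<n = contradiction j+1<n (<-irrefl j+1≡n)
... | no  _     = refl

evenIndex oddIndex : ∀ {n} → Fin n → Fin (n * 2)
evenIndex h = combine h 0F
oddIndex  h = combine h 1F

toℕ-evenIndex : ∀ {n} (h : Fin n) → toℕ (evenIndex h) ≡ toℕ h + toℕ h
toℕ-evenIndex h = trans (toℕ-combine h 0F) (trans (+-identityʳ _) (cong (toℕ h +_) (+-identityʳ _)))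

toℕ-oddIndex : ∀ {n} (h : Fin n) → toℕ (oddIndex h) ≡ suc (toℕ h + toℕ h)
toℕ-oddIndex h = trans (toℕ-combine h 1F) (trans (+-comm _ 1) (cong suc (cong (toℕ h +_) (+-identityʳ _))))

n*2≡n+n : ∀ n → n * 2 ≡ n + n
n*2≡n+n n = trans (*-comm n 2) (cong (n +_) (+-identityʳ n))

suc-evenIndex : ∀ {n} (h : Fin n) → suc (toℕ (evenIndex h)) ≡ toℕ (oddIndex h)
suc-evenIndex h = trans (cong suc (toℕ-evenIndex h)) (sym (toℕ-oddIndex h))

next-evenIndex : ∀ {n} (h : Fin n) → next (evenIndex h) ≡ oddIndex h
next-evenIndex {n} h = toℕ-injective (trans
  (toℕ-next-< (evenIndex h) (subst (_< n * 2) (sym (suc-evenIndex h)) (toℕ<n (oddIndex h))))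
  (suc-evenIndex h))

next-oddIndex : ∀ {n} (h : Fin n) → next (oddIndex h) ≡ evenIndex (next h)
next-oddIndex {n} h = toℕ-injective (by-position (m≤n⇒m<n∨m≡n (toℕ<n h)))
  where
  open ≡-Reasoning
  by-position : suc (toℕ h) < n ⊎ suc (toℕ h) ≡ n → toℕ (next (oddIndex h)) ≡ toℕ (evenIndex (next h))
  by-position (inj₁ h+1<n) =
    trans (toℕ-next-< (oddIndex h) (subst (_< n * 2) even≡ (toℕ<n (evenIndex (next h))))) (sym even≡)
    where
    even≡ : toℕ (evenIndex (next h)) ≡ suc (toℕ (oddIndex h))
    even≡ = begin
      toℕ (evenIndex (next h))    ≡⟨ toℕ-evenIndex (next h) ⟩
      toℕ (next h) + toℕ (next h) ≡⟨ cong (λ x → x + x) (toℕ-next-< h h+1<n) ⟩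
      suc (toℕ h) + suc (toℕ h)   ≡⟨ cong suc (+-suc _ _) ⟩
      suc (suc (toℕ h + toℕ h))   ≡⟨ cong suc (toℕ-oddIndex h) ⟨
      suc (toℕ (oddIndex h))      ∎
  by-position (inj₂ h+1≡n) = begin
    toℕ (next (oddIndex h))     ≡⟨ toℕ-next-last (oddIndex h) wraps ⟩
    0                           ≡⟨ cong (λ x → x + x) (toℕ-next-last h h+1≡n) ⟨
    toℕ (next h) + toℕ (next h) ≡⟨ toℕ-evenIndex (next h) ⟨
    toℕ (evenIndex (next h))    ∎
    where
    wraps : suc (toℕ (oddIndex h)) ≡ n * 2
    wraps = begin
      suc (toℕ (oddIndex h))    ≡⟨ cong suc (toℕ-oddIndex h) ⟩
      suc (suc (toℕ h + toℕ h)) ≡⟨ cong suc (+-suc _ _) ⟨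
      suc (toℕ h) + suc (toℕ h) ≡⟨ cong (λ x → x + x) h+1≡n ⟩
      n + n                     ≡⟨ n*2≡n+n n ⟨
      n * 2                     ∎

remQuot-injective : ∀ {n k} {i j : Fin (n * k)} → remQuot {n} k i ≡ remQuot k j → i ≡ j
remQuot-injective {n} {k} {i} {j} eq =
  trans (sym (combine-remQuot {n} k i)) (trans (cong (uncurry combine) eq) (combine-remQuot {n} k j))

-- The edges of G(t, s)

Adjacent : ∀ {t s} → GV t s → GV t s → Set
Adjacent {t} {s} u v = (u , v) ∈ edges (G t s) ⊎ (v , u) ∈ edges (G t s)

cycle-edge-∈ : ∀ {t s} (j : Fin (2 * t * 2)) → (cyc j , cyc (next j)) ∈ edges (G t s)
cycle-edge-∈ j = ∈-++⁺ˡ (∈-map⁺ _ (∈-allFin j))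

added-edge-∈ : ∀ {t s} (h : Fin (2 * t)) (k : Fin (s ∸ 1)) {e} →
               e ∈ (new h k , cyc (even {t} h)) ∷ (new h k , cyc (next (next (even {t} h)))) ∷ [] →
               e ∈ edges (G t s)
added-edge-∈ {t} {s} h k e∈ =
  ∈-++⁺ʳ (cycleEdges t s) (∈-concat⁺′ (∈-concat⁺′ e∈ (∈-map⁺ _ (∈-allFin k))) (∈-map⁺ _ (∈-allFin h)))

module _ {t s : ℕ} (h : Fin (2 * t)) where

  oddIndex-adjacent-evenIndex : Adjacent {t} {s} (cyc (oddIndex h)) (cyc (evenIndex h))
  oddIndex-adjacent-evenIndex =
    inj₂ (subst (λ j → (cyc (evenIndex h) , cyc j) ∈ edges (G t s)) (next-evenIndex h) (cycle-edge-∈ (evenIndex h)))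

  oddIndex-adjacent-next : Adjacent {t} {s} (cyc (oddIndex h)) (cyc (evenIndex (next h)))
  oddIndex-adjacent-next =
    inj₁ (subst (λ j → (cyc (oddIndex h) , cyc j) ∈ edges (G t s)) (next-oddIndex h) (cycle-edge-∈ (oddIndex h)))

  new-adjacent-evenIndex : (k : Fin (s ∸ 1)) → Adjacent (new h k) (cyc (evenIndex h))
  new-adjacent-evenIndex k = inj₁ (added-edge-∈ {t} {s} h k (here refl))

  new-adjacent-next : (k : Fin (s ∸ 1)) → Adjacent (new h k) (cyc (evenIndex (next h)))
  new-adjacent-next k =
    inj₁ (subst (λ j → (new h k , cyc j) ∈ edges (G t s))
                (trans (cong next (next-evenIndex h)) (next-oddIndex h))
                (added-edge-∈ {t} {s} h k (there (here refl))))

size-G : ∀ t σ → size (G t (suc σ)) ≡ suc σ * (2 * t * 2)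
size-G t σ = begin
  length (cycleEdges t s ++ addedEdges t s)              ≡⟨ length-++ (cycleEdges t s) ⟩
  length (cycleEdges t s) + length (addedEdges t s)      ≡⟨ cong₂ _+_ cycle-length added-length ⟩
  F + N * (σ * 2)                                        ≡⟨ cong (F +_) (*-comm N (σ * 2)) ⟩
  F + σ * 2 * N                                          ≡⟨ cong (F +_) (*-assoc σ 2 N) ⟩
  F + σ * (2 * N)                                        ≡⟨ cong (λ x → F + σ * x) (*-comm 2 N) ⟩
  F + σ * F                                              ∎
  where
  open ≡-Reasoning
  s N F : ℕ
  s = suc σ
  N = 2 * t
  F = N * 2
  cycle-length : length (cycleEdges t s) ≡ F
  cycle-length = trans (length-map _ (allFin F)) (length-allFin F)
  added-length : length (addedEdges t s) ≡ N * (σ * 2)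
  added-length = trans (length-concatMap-const _ (λ h → trans (length-concatMap-const _ (λ _ → refl) (allFin σ))
                                                               (cong (_* 2) (length-allFin σ)))
                                               (allFin N))
                       (cong (_* (σ * 2)) (length-allFin N))

-- The labeling

module Labeling (t σ : ℕ) (t>0 : 0 < t) where

  s N F : ℕ
  s = suc σ
  N = 2 * t
  F = N * 2

  N≡t+t : N ≡ t + t
  N≡t+t = cong (t +_) (+-identityʳ t)

  F≡N+N : F ≡ N + N
  F≡N+N = n*2≡n+n N

  t<N : t < N
  t<N = subst (t <_) (sym N≡t+t) (m<m+n t t>0)

  N<F : N < F
  N<F = subst (N <_) (sym F≡N+N) (m<m+n N (<-trans t>0 t<N))

  instance
    N-nonZero : NonZero N
    N-nonZero = >-nonZero (<-trans t>0 t<N)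

    F-nonZero : NonZero F
    F-nonZero = >-nonZero (<-trans (<-trans t>0 t<N) N<F)

  depth : ℕ → ℕ
  depth h with h <? t
  ... | yes _ = h
  ... | no  _ = suc h

  depth-< : ∀ {h} → h < t → depth h ≡ h
  depth-< {h} h<t with h <? t
  ... | yes _   = refl
  ... | no  h≮t = contradiction h<t h≮t

  depth-≥ : ∀ {h} → t ≤ h → depth h ≡ suc h
  depth-≥ {h} t≤h with h <? t
  ... | yes h<t = contradiction t≤h (<⇒≱ h<t)
  ... | no  _   = refl

  depth≤1+h : ∀ h → depth h ≤ suc h
  depth≤1+h h with h <? t
  ... | yes _ = n≤1+n h
  ... | no  _ = ≤-refl

  depth-mono-< : ∀ {h h′} → h < h′ → depth h < depth h′
  depth-mono-< {h} {h′} h<h′ = by-cases (h′ <? t)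
    where
    by-cases : Dec (h′ < t) → depth h < depth h′
    by-cases (yes h′<t) = subst₂ _<_ (sym (depth-< (<-trans h<h′ h′<t))) (sym (depth-< h′<t)) h<h′
    by-cases (no  h′≮t) = subst (depth h <_) (sym (depth-≥ (≮⇒≥ h′≮t))) (s≤s (≤-trans (depth≤1+h h) h<h′))

  depth-injective : ∀ {h h′} → depth h ≡ depth h′ → h ≡ h′
  depth-injective {h} {h′} eq with <-cmp h h′
  ... | tri< h<h′ _ _ = contradiction eq (<⇒≢ (depth-mono-< h<h′))
  ... | tri≈ _ h≡h′ _ = h≡h′
  ... | tri> _ _ h>h′ = contradiction (sym eq) (<⇒≢ (depth-mono-< h>h′))

  depth≤N : ∀ {h} → h < N → depth h ≤ N
  depth≤N {h} h<N = ≤-trans (depth≤1+h h) h<N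

  hubLabel : ℕ → ℕ → ℕ
  hubLabel h k = k * F + (F ∸ depth h)

  hub-offset>0 : ∀ {h} → h < N → 0 < F ∸ depth h
  hub-offset>0 h<N = m<n⇒0<n∸m (≤-<-trans (depth≤N h<N) N<F)

  N≤hubLabel : ∀ {h} k → h < N → N ≤ hubLabel h k
  N≤hubLabel {h} k h<N = begin
    N           ≡⟨ m+n∸n≡m N N ⟨
    N + N ∸ N   ≡⟨ cong (_∸ N) F≡N+N ⟨
    F ∸ N       ≤⟨ ∸-monoʳ-≤ F (depth≤N h<N) ⟩
    F ∸ depth h ≤⟨ m≤n+m _ (k * F) ⟩
    hubLabel h k ∎
    where open ≤-Reasoning

  hubLabel≤ : ∀ h k → hubLabel h k ≤ suc k * F
  hubLabel≤ h k = ≤-trans (+-monoʳ-≤ (k * F) (m∸n≤m F (depth h))) (≤-reflexive (+-comm (k * F) F))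

  hubLabel-injective : ∀ {h h′ k k′} → h < N → h′ < N → hubLabel h k ≡ hubLabel h′ k′ → h ≡ h′ × k ≡ k′
  hubLabel-injective {h} {h′} h<N h′<N eq
    with k≡k′ , offset≡ ← *+-injective F (hub-offset>0 h<N) (m∸n≤m F (depth h)) (hub-offset>0 h′<N) (m∸n≤m F (depth h′)) eq
    = depth-injective (∸-cancelˡ-≡ (depth≤F h<N) (depth≤F h′<N) offset≡) , k≡k′
    where
    depth≤F : ∀ {h} → h < N → depth h ≤ F
    depth≤F h<N = ≤-trans (depth≤N h<N) (<⇒≤ N<F)

  -- rim h is v_{2h}; hub h k is the hub of layer k joined to v_{2h} and v_{2h+2}.
  data Position : Set where
    rim : Fin N → Position
    hub : Fin N → ℕ → Position

  label : Position → ℕ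
  label (rim h)   = toℕ h
  label (hub h k) = hubLabel (toℕ h) k

  cyclePosition : Fin N × Fin 2 → Position
  cyclePosition (h , 0F) = rim h
  cyclePosition (h , 1F) = hub h σ

  position : GV t s → Position
  position (cyc j)   = cyclePosition (remQuot 2 j)
  position (new h k) = hub h (toℕ k)

  φ : GV t s → ℕ
  φ = label ∘ position

  φ-evenIndex : ∀ h → φ (cyc (evenIndex h)) ≡ toℕ h
  φ-evenIndex h = cong (label ∘ cyclePosition) (remQuot-combine h 0F)

  φ-oddIndex : ∀ h → φ (cyc (oddIndex h)) ≡ hubLabel (toℕ h) σ
  φ-oddIndex h = cong (label ∘ cyclePosition) (remQuot-combine h 1F)

  hub-injective : ∀ {h h′ k k′} → hub h k ≡ hub h′ k′ → h ≡ h′ × k ≡ k′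
  hub-injective refl = refl , refl

  cyclePosition-injective : ∀ {c c′} → cyclePosition c ≡ cyclePosition c′ → c ≡ c′
  cyclePosition-injective {_ , 0F} {_ , 0F} refl = refl
  cyclePosition-injective {_ , 1F} {_ , 1F} refl = refl
  cyclePosition-injective {_ , 0F} {_ , 1F} ()
  cyclePosition-injective {_ , 1F} {_ , 0F} ()

  cyclePosition≢new : ∀ c h (k : Fin σ) → cyclePosition c ≢ hub h (toℕ k)
  cyclePosition≢new (_ , 0F) h k ()
  cyclePosition≢new (_ , 1F) h k eq = <-irrefl (sym (proj₂ (hub-injective eq))) (toℕ<n k)

  position-injective : ∀ u v → position u ≡ position v → u ≡ v
  position-injective (cyc j)   (cyc j′)    eq = cong cyc (remQuot-injective (cyclePosition-injective eq))
  position-injective (cyc j)   (new h k)   eq = contradiction eq (cyclePosition≢new (remQuot 2 j) h k)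
  position-injective (new h k) (cyc j)     eq = contradiction (sym eq) (cyclePosition≢new (remQuot 2 j) h k)
  position-injective (new h k) (new h′ k′) eq
    with refl , k≡k′ ← hub-injective eq = cong (new h) (toℕ-injective k≡k′)

  label-injective : ∀ p p′ → label p ≡ label p′ → p ≡ p′
  label-injective (rim h)   (rim h′)    eq = cong rim (toℕ-injective eq)
  label-injective (rim h)   (hub h′ k′) eq = contradiction (toℕ<n h) (≤⇒≯ (subst (N ≤_) (sym eq) (N≤hubLabel k′ (toℕ<n h′))))
  label-injective (hub h k) (rim h′)    eq = contradiction (toℕ<n h′) (≤⇒≯ (subst (N ≤_) eq (N≤hubLabel k (toℕ<n h))))
  label-injective (hub h k) (hub h′ k′) eq
    with h≡h′ , refl ← hubLabel-injective {k = k} {k′ = k′} (toℕ<n h) (toℕ<n h′) eq = cong (λ i → hub i k) (toℕ-injective h≡h′)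

  φ-injective : ∀ u v → φ u ≡ φ v → u ≡ v
  φ-injective u v = position-injective u v ∘ label-injective (position u) (position v)

  layer≤ : ∀ {k} h → k ≤ σ → hubLabel h k ≤ s * F
  layer≤ {k} h k≤σ = ≤-trans (hubLabel≤ h k) (*-monoˡ-≤ F (s≤s k≤σ))

  φ≤ : ∀ v → φ v ≤ s * F
  φ≤ (cyc j)   = cycle≤ (remQuot 2 j)
    where
    cycle≤ : ∀ c → label (cyclePosition c) ≤ s * F
    cycle≤ (h , 0F) = ≤-trans (<⇒≤ (<-trans (toℕ<n h) N<F)) (m≤m+n F (σ * F))
    cycle≤ (h , 1F) = layer≤ (toℕ h) ≤-refl
  φ≤ (new h k) = layer≤ (toℕ h) (<⇒≤ (toℕ<n k))

  edgeLabels : List ℕ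
  edgeLabels = map (λ e → ∣ φ (proj₁ e) - φ (proj₂ e) ∣) (edges (G t s))

  adjacent-label-∈ : ∀ {u v} → Adjacent u v → ∣ φ u - φ v ∣ ∈ edgeLabels
  adjacent-label-∈           (inj₁ uv∈) = ∈-map⁺ _ uv∈
  adjacent-label-∈ {u} {v}   (inj₂ vu∈) = subst (_∈ edgeLabels) (∣-∣-comm (φ v) (φ u)) (∈-map⁺ _ vu∈)

  NeighbourLabel : Fin N → ℕ → Set
  NeighbourLabel h a = a ≡ toℕ h ⊎ a ≡ toℕ (next h)

  hubVertex : Fin N → ∀ {k} → k < σ ⊎ k ≡ σ → GV t s
  hubVertex h (inj₁ k<σ) = new h (fromℕ< k<σ)
  hubVertex h (inj₂ _)   = cyc (oddIndex h)

  φ-hubVertex : ∀ h {k} (layer : k < σ ⊎ k ≡ σ) → φ (hubVertex h layer) ≡ hubLabel (toℕ h) k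
  φ-hubVertex h (inj₁ k<σ)  = cong (hubLabel (toℕ h)) (toℕ-fromℕ< k<σ)
  φ-hubVertex h (inj₂ refl) = φ-oddIndex h

  hubVertex-adjacent : ∀ h {k} (layer : k < σ ⊎ k ≡ σ) {a} → NeighbourLabel h a →
                       ∃[ v ] φ v ≡ a × Adjacent (hubVertex h layer) v
  hubVertex-adjacent h (inj₁ _) (inj₁ refl) = _ , φ-evenIndex h        , new-adjacent-evenIndex h _
  hubVertex-adjacent h (inj₁ _) (inj₂ refl) = _ , φ-evenIndex (next h) , new-adjacent-next h _
  hubVertex-adjacent h (inj₂ _) (inj₁ refl) = _ , φ-evenIndex h        , oddIndex-adjacent-evenIndex h
  hubVertex-adjacent h (inj₂ _) (inj₂ refl) = _ , φ-evenIndex (next h) , oddIndex-adjacent-next h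

  depth+neighbour<F : ∀ h {a} → NeighbourLabel h a → depth (toℕ h) + a < F
  depth+neighbour<F h {a} nb = subst (depth (toℕ h) + a <_) (sym F≡N+N) (+-mono-≤-< (depth≤N (toℕ<n h)) (neighbour<N nb))
    where
    neighbour<N : ∀ {a} → NeighbourLabel h a → a < N
    neighbour<N (inj₁ refl) = toℕ<n h
    neighbour<N (inj₂ refl) = toℕ<n (next h)

  hub-difference : ∀ h k {a} → NeighbourLabel h a → ∣ hubLabel (toℕ h) k - a ∣ ≡ k * F + (F ∸ (depth (toℕ h) + a))
  hub-difference h k {a} nb = begin
    ∣ k * F + (F ∸ d) - a ∣ ≡⟨ m≤n⇒∣n-m∣≡n∸m (≤-trans a≤F∸d (m≤n+m _ (k * F))) ⟩
    k * F + (F ∸ d) ∸ a     ≡⟨ +-∸-assoc (k * F) a≤F∸d ⟩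
    k * F + (F ∸ d ∸ a)     ≡⟨ cong (k * F +_) (∸-+-assoc F d a) ⟩
    k * F + (F ∸ (d + a))   ∎
    where
    open ≡-Reasoning
    d = depth (toℕ h)
    a≤F∸d : a ≤ F ∸ d
    a≤F∸d = m+n≤o⇒m≤o∸n a (subst (_≤ F) (+-comm d a) (<⇒≤ (depth+neighbour<F h nb)))

  hub-difference-∈ : ∀ h {k} → k < σ ⊎ k ≡ σ → ∀ {a} → NeighbourLabel h a →
                     k * F + (F ∸ (depth (toℕ h) + a)) ∈ edgeLabels
  hub-difference-∈ h {k} layer nb
    with v , φv≡a , adjacent ← hubVertex-adjacent h layer nb =
    subst (_∈ edgeLabels) (trans (cong₂ ∣_-_∣ (φ-hubVertex h layer) φv≡a) (hub-difference h k nb))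
          (adjacent-label-∈ adjacent)

  Covered : ℕ → Set
  Covered m = ∃[ h ] ∃[ a ] NeighbourLabel h a × m ≡ depth (toℕ h) + a

  covered-by-rim : ∀ {m h} → h < N → m ≡ depth h + h → Covered m
  covered-by-rim h<N eq =
    fromℕ< h<N , _ , inj₁ refl , trans eq (cong (λ x → depth x + x) (sym (toℕ-fromℕ< h<N)))

  covered-by-next-rim : ∀ {m h} → suc h < N → m ≡ depth h + suc h → Covered m
  covered-by-next-rim {h = h} h+1<N eq =
    i , _ , inj₂ refl , trans eq (cong₂ (λ x y → depth x + y) (sym toℕ-i) (sym toℕ-next-i))
    where
    i = fromℕ< (<-trans (n<1+n h) h+1<N)
    toℕ-i : toℕ i ≡ h
    toℕ-i = toℕ-fromℕ< _
    toℕ-next-i : toℕ (next i) ≡ suc h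
    toℕ-next-i = trans (toℕ-next-< i (subst (λ x → suc x < N) (sym toℕ-i) h+1<N)) (cong suc toℕ-i)

  -- The hub v_{4t−1} is joined to v_0 across the wrap-around of the cycle.
  covered-by-wrap : Covered N
  covered-by-wrap = i , _ , inj₂ refl , sym (begin
    depth (toℕ i) + toℕ (next i) ≡⟨ cong₂ _+_ (trans (cong depth toℕ-i) (depth-≥ (<⇒≤pred t<N))) (toℕ-next-last i last) ⟩
    suc (pred N) + 0             ≡⟨ +-identityʳ _ ⟩
    suc (pred N)                 ≡⟨ suc-pred N ⟩
    N                            ∎)
    where
    open ≡-Reasoning
    i = fromℕ< (subst (pred N <_) (suc-pred N) (n<1+n (pred N)))
    toℕ-i : toℕ i ≡ pred N
    toℕ-i = toℕ-fromℕ< _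
    last : suc (toℕ i) ≡ N
    last = trans (cong suc toℕ-i) (suc-pred N)

  layer-cover : ∀ m → m < F → Covered m
  layer-cover m m<F with parity m | subst (m <_) F≡N+N m<F
  ... | q , inj₁ refl | 2q<2N with <-cmp q t
  ...   | tri< q<t _ _               = covered-by-rim (<-trans q<t t<N) (cong (_+ q) (sym (depth-< q<t)))
  ...   | tri≈ _ refl _              = subst Covered N≡t+t covered-by-wrap
  ...   | tri> _ _ (s≤s {n = p} t≤p) = covered-by-next-rim {h = p} (double-<-cancel 2q<2N) (cong (_+ suc p) (sym (depth-≥ t≤p)))
  layer-cover m m<F | q , inj₂ refl | 2q+1<2N with q <? t
  ...   | yes q<t = covered-by-next-rim (≤-<-trans q<t t<N) (trans (sym (+-suc q q)) (cong (_+ suc q) (sym (depth-< q<t))))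
  ...   | no  q≮t = covered-by-rim (double-<-cancel (<-trans (n<1+n _) 2q+1<2N)) (cong (_+ q) (sym (depth-≥ (≮⇒≥ q≮t))))

  covered-∈ : ∀ {k m} → k < s → Covered m → k * F + (F ∸ m) ∈ edgeLabels
  covered-∈ k<s (h , a , nb , refl) = hub-difference-∈ h (m≤n⇒m<n∨m≡n (s≤s⁻¹ k<s)) nb

  edgeLabels-⊇ : map suc (upTo (s * F)) ⊆ edgeLabels
  edgeLabels-⊇ y∈ with x , x∈ , refl ← ∈-map⁻ suc y∈ =
    subst (_∈ edgeLabels) in-block (covered-∈ (m<n*o⇒m/o<n (∈-upTo⁻ x∈)) (layer-cover (F ∸ suc r) top<F))
    where
    open ≡-Reasoning
    k r : ℕ
    k = x / F
    r = x % F
    top<F : F ∸ suc r < F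
    top<F = ∸-monoʳ-< z<s (m%n<n x F)
    in-block : k * F + (F ∸ (F ∸ suc r)) ≡ suc x
    in-block = begin
      k * F + (F ∸ (F ∸ suc r)) ≡⟨ cong (k * F +_) (m∸[m∸n]≡n (m%n<n x F)) ⟩
      k * F + suc r             ≡⟨ +-comm (k * F) (suc r) ⟩
      suc (r + k * F)           ≡⟨ cong suc (m≡m%n+[m/n]*n x F) ⟨
      suc x                     ∎

  graceful : IsGracefulLabeling (G t s) φ
  graceful rewrite size-G t σ =
    φ-injective , φ≤ , unique-⊆-length⇒↭ (Unique.map⁺ suc-injective (Unique.upTo⁺ (s * F))) edgeLabels-⊇ same-length
    where
    same-length : length edgeLabels ≤ length (map suc (upTo (s * F)))
    same-length = ≤-reflexive (begin
      length edgeLabels              ≡⟨ length-map _ (edges (G t s)) ⟩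
      size (G t s)                   ≡⟨ size-G t σ ⟩
      s * F                          ≡⟨ length-upTo (s * F) ⟨
      length (upTo (s * F))          ≡⟨ length-map suc (upTo (s * F)) ⟨
      length (map suc (upTo (s * F))) ∎)
      where open ≡-Reasoning

mainTheorem1 : (t s : ℕ) → 1 ≤ t → 1 ≤ s → Graceful (G t s)
mainTheorem1 t zero    _   ()
mainTheorem1 t (suc σ) t>0 _ = φ , graceful
  where open Labeling t σ t>0
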